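{- Fix $n \geq 0$ and let $\pi \in S_n$. Then $maj(\pi) = ch(f(\pi))$, where $f(\pi) = ((\pi^r)^c)^{ -1}$.
   Context: $S_n$ is the set of permutations of $[n]$ in one-line notation $\pi=\pi_1\cdots\pi_n$. The reverse is $\pi^r=\pi_n\cdots\pi_1$, the complement is $\pi^c=(n+1-\pi_1)(n+1-\pi_2)\cdots(n+1-\pi_n)$, and $\pi^{ -1}$ is the usual group inverse. $Des(\pi)=\{i:\pi_i>\pi_{i+1}\}$ and $maj(\pi)=\sum_{i\in Des(\pi)} i$. For $\pi\in S_n$, the charge value of $i\in[n]$ is: $chv(1)=0$; for $i\ge 2$, $chv(i)=0$ if $i$ is to the right of $i-1$ in $\pi$ and $chv(i)=n+1-i$ if $i$ is to the left of $i-1$ in $\pi$. The charge is $ch(\pi)=\sum_{i=1}^n chv(i)$. -}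

module Defs where

open import Data.Nat using (ℕ; zero; suc; _∸_; _<ᵇ_)
open import Data.Bool using (if_then_else_)
open import Data.Fin using (Fin; toℕ; inject₁) renaming (suc to fsuc)
open import Data.Fin.Permutation using (Permutation′; _⟨$⟩ʳ_; _⟨$⟩ˡ_; flip; _∘ₚ_; reverse)
open import Data.List using (List; map; allFin)
open import Data.Nat.ListAction using (sum)

-- One-line notation with 0-based shift: π_{i+1} = toℕ (π ⟨$⟩ʳ i) + 1.
-- Comparisons of values/positions are order-isomorphic under this shift.

-- reverse π^r : π^r_i = π_{n+1-i}   (i ↦ π (opposite i))
rev : {n : ℕ} → Permutation′ n → Permutation′ n
rev π = reverse ∘ₚ π

-- complement π^c : π^c_i = n + 1 - π_i   (i ↦ opposite (π i))
comp : {n : ℕ} → Permutation′ n → Permutation′ n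
comp π = π ∘ₚ reverse

inv : {n : ℕ} → Permutation′ n → Permutation′ n
inv π = flip π

-- maj(π) = Σ_{i ∈ Des(π)} i, Des(π) = {i ∈ [n-1] : π_i > π_{i+1}}.
-- For n = suc m, i : Fin m stands for the 1-based position toℕ i + 1,
-- comparing π at 0-based positions inject₁ i and fsuc i.
maj : {n : ℕ} → Permutation′ n → ℕ
maj {zero} π = 0
maj {suc m} π = sum (map term (allFin m))
  where
  term : Fin m → ℕ
  term i = if toℕ (π ⟨$⟩ʳ fsuc i) <ᵇ toℕ (π ⟨$⟩ʳ inject₁ i)
           then suc (toℕ i) else 0

-- charge: chv(1) = 0; for a value i ≥ 2, chv(i) = n + 1 - i if i is to the
-- left of i-1 in π, else 0.  For n = suc m, v : Fin m stands for the value
-- i = toℕ v + 2 (0-based: fsuc v), whose predecessor i-1 is 0-based inject₁ v;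
-- n + 1 - i = (suc m + 1) ∸ (toℕ v + 2).
chv : {m : ℕ} → Permutation′ (suc m) → Fin m → ℕ
chv {m} π v =
  if toℕ (π ⟨$⟩ˡ fsuc v) <ᵇ toℕ (π ⟨$⟩ˡ inject₁ v)
  then suc (suc m) ∸ suc (suc (toℕ v)) else 0

ch : {n : ℕ} → Permutation′ n → ℕ
ch {zero} π = 0
ch {suc m} π = sum (map (chv π) (allFin m))

f : {n : ℕ} → Permutation′ n → Permutation′ n
f π = inv (comp (rev π))

-- Since rev π ⟨$⟩ʳ i = π (opposite i) and comp replaces a value j by opposite j,
-- the inverse of f(π) is x ↦ opposite (π (opposite x)).  Hence a value i ≥ 2
-- lies to the left of i - 1 in f(π) exactly when π has a descent at position
-- n + 1 - i, which is also the charge value of i.  Reindexing the charge sum by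
-- i ↦ n + 1 - i therefore turns it term by term into the major index of π.
module Submission where

open import Defs
open import Data.Nat using (ℕ; zero; suc; _+_; _∸_; _<ᵇ_; _<_; s<s)
open import Data.Nat.Properties
  using (<ᵇ⇒<; <⇒<ᵇ; <ᵇ-reflects-<; ∸-monoʳ-<; +-∸-assoc; +-0-commutativeMonoid)
open import Data.Bool using (if_then_else_)
open import Data.Fin using (Fin; toℕ; inject₁; opposite) renaming (suc to fsuc; zero to fzero)
open import Data.Fin.Properties using (toℕ<n; opposite-prop; opposite-involutive)
open import Data.Fin.Permutation using (Permutation′; _⟨$⟩ʳ_; reverse)
open import Data.List using (map; allFin; tabulate)
open import Data.List.Properties using (map-tabulate; map-cong)
open import Data.Nat.ListAction using (sum)
open import Function using (_∘_; id)
open import Relation.Nullary.Reflects using (Reflects; fromEquivalence; det)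
open import Relation.Binary.PropositionalEquality

import Algebra.Properties.CommutativeMonoid.Sum +-0-commutativeMonoid as Σ

sum-tabulate : ∀ {m} (h : Fin m → ℕ) → sum (tabulate h) ≡ Σ.sum h
sum-tabulate {zero}  h = refl
sum-tabulate {suc m} h = cong (h fzero +_) (sum-tabulate (h ∘ fsuc))

sum-map-allFin-∘-opposite : ∀ {m} (h : Fin m → ℕ) →
  sum (map h (allFin m)) ≡ sum (map (h ∘ opposite) (allFin m))
sum-map-allFin-∘-opposite {m} h = begin
  sum (map h (allFin m))                ≡⟨ cong sum (map-tabulate id h) ⟩
  sum (tabulate h)                      ≡⟨ sum-tabulate h ⟩
  Σ.sum h                               ≡⟨ Σ.sum-permute h reverse ⟩
  Σ.sum (h ∘ opposite)                  ≡⟨ sum-tabulate (h ∘ opposite) ⟨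
  sum (tabulate (h ∘ opposite))         ≡⟨ cong sum (map-tabulate id (h ∘ opposite)) ⟨
  sum (map (h ∘ opposite) (allFin m))   ∎
  where open ≡-Reasoning

opposite-inject₁ : ∀ {n} (i : Fin n) → opposite (inject₁ i) ≡ fsuc (opposite i)
opposite-inject₁ {suc n} fzero    = refl
opposite-inject₁ {suc n} (fsuc i) = cong inject₁ (opposite-inject₁ i)

suc-toℕ-opposite : ∀ {n} (i : Fin n) → suc (toℕ (opposite i)) ≡ n ∸ toℕ i
suc-toℕ-opposite {n} i = begin
  suc (toℕ (opposite i))  ≡⟨ cong suc (opposite-prop i) ⟩
  suc (n ∸ suc (toℕ i))   ≡⟨ +-∸-assoc 1 (toℕ<n i) ⟨
  n ∸ toℕ i               ∎
  where open ≡-Reasoning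

opposite-reverses-< : ∀ {n} {i j : Fin n} →
  toℕ i < toℕ j → toℕ (opposite j) < toℕ (opposite i)
opposite-reverses-< {i = i} {j} i<j rewrite opposite-prop i | opposite-prop j =
  ∸-monoʳ-< (s<s i<j) (toℕ<n j)

opposite-reflects-< : ∀ {n} {i j : Fin n} →
  toℕ (opposite i) < toℕ (opposite j) → toℕ j < toℕ i
opposite-reflects-< {i = i} {j} oi<oj =
  subst₂ (λ a b → toℕ a < toℕ b) (opposite-involutive j) (opposite-involutive i)
    (opposite-reverses-< oi<oj)

opposite-<ᵇ : ∀ {n} (i j : Fin n) →
  (toℕ (opposite i) <ᵇ toℕ (opposite j)) ≡ (toℕ j <ᵇ toℕ i)
opposite-<ᵇ i j = det reflects (<ᵇ-reflects-< (toℕ j) (toℕ i))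
  where
  reflects : Reflects (toℕ j < toℕ i) (toℕ (opposite i) <ᵇ toℕ (opposite j))
  reflects = fromEquivalence (opposite-reflects-< ∘ <ᵇ⇒< _ _)
                             (<⇒<ᵇ ∘ opposite-reverses-<)

descentWeight : ∀ {m} → Permutation′ (suc m) → Fin m → ℕ
descentWeight π i = if toℕ (π ⟨$⟩ʳ fsuc i) <ᵇ toℕ (π ⟨$⟩ʳ inject₁ i)
                    then suc (toℕ i) else 0

chv-f≗descentWeight∘opposite : ∀ {m} (π : Permutation′ (suc m)) →
  chv (f π) ≗ descentWeight π ∘ opposite
chv-f≗descentWeight∘opposite π v
  rewrite opposite-inject₁ v
        | opposite-<ᵇ (π ⟨$⟩ʳ inject₁ (opposite v)) (π ⟨$⟩ʳ fsuc (opposite v))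
        | suc-toℕ-opposite v = refl

lemma1 : (n : ℕ) (π : Permutation′ n) → maj π ≡ ch (f π)
lemma1 zero    π = refl
lemma1 (suc m) π = begin
  sum (map (descentWeight π) (allFin m))
    ≡⟨ sum-map-allFin-∘-opposite (descentWeight π) ⟩
  sum (map (descentWeight π ∘ opposite) (allFin m))
    ≡⟨ cong sum (map-cong (sym ∘ chv-f≗descentWeight∘opposite π) (allFin m)) ⟩
  sum (map (chv (f π)) (allFin m))
    ∎
  where open ≡-Reasoning
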